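{- For $n\ge 1$ let $\pi_n$ be the rank of the $\mathbb{Z}$-module $\Xi^n$. Then $\pi_1=1$, $\pi_2=1$, $\pi_3=2$, $\pi_4=4$, and $\pi_n=\pi_{n-1}+\pi_{n-2}+\pi_{n-4}$ for all $n\ge 5$.
   Context: A composition $\alpha=[\alpha_1,\ldots,\alpha_k]$ of $n$ ($\alpha\vDash n$) is an ordered list of positive integers summing to $n$; $k(\alpha)=k$; $I(\alpha)=\{\alpha_1,\alpha_1+\alpha_2,\ldots,\alpha_1+\cdots+\alpha_{k-1}\}\subset[n-1]$, $A+1=\{a+1:a\in A\}$. $M_\alpha=\sum_{i_1<\cdots<i_k}x_{i_1}^{\alpha_1}\cdots x_{i_k}^{\alpha_k}$. For $\alpha\vDash n$, $\theta_\alpha=\sum_{\beta\vDash n,\ I(\alpha)\subset I(\beta)\cup(I(\beta)+1)}2^{k(\beta)}M_\beta$. $\theta_\alpha$ ($\alpha\vDash n$) is a shifted quasi-symmetric function if $n\le 1$ or $\alpha_1>1$. $\Xi^n$ is the $\mathbb{Z}$-module spanned by all shifted quasi-symmetric functions $\theta_\alpha$ with $\alpha\vDash n$. -}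

module Defs where

open import Data.Bool using (Bool; true; false; _∧_; if_then_else_; T)
open import Data.Nat using (ℕ; zero; suc; _+_; _^_; _≤_; _<_; _≡ᵇ_; _≤ᵇ_)
open import Data.List using (List; []; _∷_; map; length; _++_)
open import Data.Bool.ListAction using (all; any)
open import Data.Nat.ListAction using (sum)
open import Data.Empty using (⊥)
open import Data.Fin using (Fin; zero; suc)
open import Data.Integer using (ℤ; +_; 0ℤ) renaming (_+_ to _+ℤ_; _*_ to _*ℤ_)
open import Data.Product using (∃; _×_)
open import Data.Sum using (_⊎_)
open import Relation.Binary.PropositionalEquality using (_≡_)

isComp : ℕ → List ℕ → Bool
isComp n α = all (λ a → 1 ≤ᵇ a) α ∧ (sum α ≡ᵇ n)

I : List ℕ → List ℕ
I []            = []
I (a ∷ [])      = []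
I (a ∷ b ∷ rest) = a ∷ map (λ x → a + x) (I (b ∷ rest))

elemᵇ : ℕ → List ℕ → Bool
elemᵇ x xs = any (λ y → x ≡ᵇ y) xs

condᵇ : List ℕ → List ℕ → Bool
condᵇ α β = all (λ a → elemᵇ a (I β ++ map suc (I β))) (I α)

-- Homogeneous quasi-symmetric functions of degree n are identified with
-- their coefficient functions in the monomial basis {M_β : β ⊨ n};
-- we use functions List ℕ → ℤ (coefficient of M_β), zero off compositions of n.
QSymCoeffs : Set
QSymCoeffs = List ℕ → ℤ

θ : ℕ → List ℕ → QSymCoeffs
θ n α β = if isComp n β ∧ condᵇ α β then + (2 ^ length β) else 0ℤ

Shifted : ℕ → List ℕ → Set
Shifted n α = n ≤ 1 ⊎ ∃ λ a → ∃ λ rest → α ≡ a ∷ rest × 1 < a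

Σ : (m : ℕ) → (Fin m → ℤ) → ℤ
Σ zero    f = 0ℤ
Σ (suc m) f = f zero +ℤ Σ m (λ i → f (suc i))

InΞ : ℕ → QSymCoeffs → Set
InΞ n f = ∃ λ (m : ℕ) → ∃ λ (gens : Fin m → List ℕ) → ∃ λ (c : Fin m → ℤ) →
  (∀ i → T (isComp n (gens i)) × Shifted n (gens i)) ×
  (∀ β → f β ≡ Σ m (λ i → c i *ℤ θ n (gens i) β))

LinIndep : (r : ℕ) → (Fin r → QSymCoeffs) → Set
LinIndep r v = ∀ (c : Fin r → ℤ) →
  (∀ β → Σ r (λ i → c i *ℤ v i β) ≡ 0ℤ) → ∀ i → c i ≡ 0ℤ

HasRank : ℕ → ℕ → Set
HasRank n r =
  (∃ λ (v : Fin r → QSymCoeffs) → (∀ i → InΞ n (v i)) × LinIndep r v) ×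
  (∀ (w : Fin (suc r) → QSymCoeffs) → (∀ i → InΞ n (w i)) → LinIndep (suc r) w → ⊥)

-- Encode a composition of m + 1 by the bit string x ∈ {0,1}ᵐ of its descent set.  If y and x
-- encode α and β, the coefficient of M_β in θ_α is 2^k(β) when every bit of y is set in
-- (x₀, x₀ ∨ x₁, …, x_{m-2} ∨ x_{m-1}), and 0 otherwise.  For shifted α the first bit of y is 0,
-- so the condition depends only on pairOr x = (x_k ∨ x_{k+1})_k.  Hence on Ξ^{m+1} every
-- coordinate M_β is zero or proportional to the coordinate of a fixed representative q of the
-- fibre of pairOr through x, and the rank is at most the number of values of pairOr.  Conversely,
-- the shifted composition with bit string 0 · pairOr p gives a θ whose coordinate at the
-- representative q is nonzero exactly when pairOr p ⊆ pairOr q; ordering by the number of set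
-- bits makes this system triangular, so the rank equals the number of values of pairOr.
-- Splitting the values by their first bit gives the recurrence.

module Submission where

open import Defs
open import Data.Nat using (ℕ; suc; _+_; _≤_; _∸_)
open import Data.Product using (∃; _×_)
open import Relation.Binary.PropositionalEquality using (_≡_)

open import Data.Nat using (zero; _<_; _^_; _≤ᵇ_; _≡ᵇ_; z≤n; s≤s)
import Data.Nat.Properties as ℕ
open import Data.Nat.Properties using (≤-trans; ≤-reflexive)
open import Data.Nat.ListAction using (sum)
open import Data.Nat.Tactic.RingSolver using () renaming (solve-∀ to ℕ-solve-∀)
open import Data.Integer using (ℤ; +_; 0ℤ; 1ℤ; -_; _≟_) renaming (_+_ to _+ℤ_; _*_ to _*ℤ_; _-_ to _-ℤ_)
import Data.Integer.Properties as ℤ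
open import Data.Integer.Tactic.RingSolver using (solve-∀)
open import Data.Fin using (Fin; zero; suc; punchIn)
import Data.Fin.Properties as Fin
open import Data.Vec.Functional using (insertAt; removeAt)
open import Data.Vec.Functional.Properties using (insertAt-lookup; insertAt-punchIn)
open import Algebra.Properties.Semiring.Sum ℤ.+-*-semiring
  using (sum-syntax; sum-cong-≗; sum-remove; sum-replicate-zero; ∑-distrib-+; *-distribˡ-sum; *-distribʳ-sum)
  renaming (sum to ∑)
open import Data.Bool using (Bool; true; false; T; T?; if_then_else_; _∧_; _∨_)
import Data.Bool.Properties as Bool
open import Data.Bool.ListAction using (all; and; or)
open import Data.List using (List; []; _∷_; length; map; _++_; lookup)
import Data.List.Properties as List
open import Data.List.Relation.Unary.All as All using (All; []; _∷_)
import Data.List.Relation.Unary.All.Properties as All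
open import Data.List.Relation.Unary.Any as Any using (Any; here)
import Data.List.Relation.Unary.Any.Properties as Any
open import Data.List.Relation.Unary.AllPairs as AllPairs using (AllPairs; []; _∷_)
import Data.List.Relation.Unary.AllPairs.Properties as AllPairs
import Data.List.Membership.Propositional.Properties as Membership
open import Data.Product using (∃₂; _,_; proj₁; proj₂)
open import Data.Sum using (_⊎_; inj₁; inj₂; [_,_]′)
open import Data.Empty using (⊥-elim)
open import Function using (id; _∘_)
open import Function.Bundles using (Equivalence)
open import Relation.Nullary using (¬_; yes; no)
open import Relation.Binary.PropositionalEquality using (_≢_; refl; sym; trans; cong; cong₂; module ≡-Reasoning)
open ≡-Reasoning

-- Linear algebra over ℤ

i*j≡0∧j≢0⇒i≡0 : ∀ {i j} → i *ℤ j ≡ 0ℤ → j ≢ 0ℤ → i ≡ 0ℤ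
i*j≡0∧j≢0⇒i≡0 {i} ij≡0 j≢0 = [ id , ⊥-elim ∘ j≢0 ]′ (ℤ.i*j≡0⇒i≡0∨j≡0 i ij≡0)

i*j≡0∧i≢0⇒j≡0 : ∀ {i j} → i *ℤ j ≡ 0ℤ → i ≢ 0ℤ → j ≡ 0ℤ
i*j≡0∧i≢0⇒j≡0 {i} {j} ij≡0 = i*j≡0∧j≢0⇒i≡0 (trans (ℤ.*-comm j i) ij≡0)

Σ≡∑ : ∀ m (f : Fin m → ℤ) → Σ m f ≡ ∑ f
Σ≡∑ zero    f = refl
Σ≡∑ (suc m) f = cong (f zero +ℤ_) (Σ≡∑ m (f ∘ suc))

∑-zero : ∀ {m} {f : Fin m → ℤ} → (∀ i → f i ≡ 0ℤ) → ∑ f ≡ 0ℤ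
∑-zero {m} f≡0 = trans (sum-cong-≗ f≡0) (sum-replicate-zero m)

∑-single : ∀ {m} {f : Fin (suc m) → ℤ} j → (∀ i → i ≢ j → f i ≡ 0ℤ) → ∑ f ≡ f j
∑-single {f = f} j others = begin
  ∑ f                      ≡⟨ sum-remove f ⟩
  f j +ℤ ∑ (removeAt f j)  ≡⟨ cong (f j +ℤ_) (∑-zero (λ i → others (punchIn j i) (Fin.punchInᵢ≢i j i))) ⟩
  f j +ℤ 0ℤ                ≡⟨ ℤ.+-identityʳ (f j) ⟩
  f j                      ∎

∑-ratio : ∀ {m} (c x y : Fin m → ℤ) a b → (∀ i → a *ℤ x i ≡ b *ℤ y i) →
  a *ℤ ∑[ i < m ] (c i *ℤ x i) ≡ b *ℤ ∑[ i < m ] (c i *ℤ y i)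
∑-ratio c x y a b ax≡by = begin
  a *ℤ ∑ (λ i → c i *ℤ x i)   ≡⟨ *-distribˡ-sum a (λ i → c i *ℤ x i) ⟩
  ∑ (λ i → a *ℤ (c i *ℤ x i)) ≡⟨ sum-cong-≗ (λ i → trans (swap a (c i) (x i)) (cong (c i *ℤ_) (ax≡by i))) ⟩
  ∑ (λ i → c i *ℤ (b *ℤ y i)) ≡⟨ sum-cong-≗ (λ i → sym (swap b (c i) (y i))) ⟩
  ∑ (λ i → b *ℤ (c i *ℤ y i)) ≡⟨ *-distribˡ-sum b (λ i → c i *ℤ y i) ⟨
  b *ℤ ∑ (λ i → c i *ℤ y i)   ∎
  where
  swap : ∀ a c x → a *ℤ (c *ℤ x) ≡ c *ℤ (a *ℤ x)
  swap = solve-∀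

Dependent : ∀ {k r} → (Fin k → Fin r → ℤ) → Set
Dependent {k} {r} A =
  ∃ λ (c : Fin k → ℤ) → (∃ λ i → c i ≢ 0ℤ) × (∀ j → ∑[ i < k ] (c i *ℤ A i j) ≡ 0ℤ)

dependent-zeroColumn : ∀ {r} (A : Fin (suc (suc r)) → Fin (suc r) → ℤ) → (∀ i → A i zero ≡ 0ℤ) →
  Dependent (λ i j → A (suc i) (suc j)) → Dependent A
dependent-zeroColumn A zeroColumn (d , (i , dᵢ≢0) , d-rel) = c , (suc i , dᵢ≢0) , c-rel
  where
  c : Fin _ → ℤ
  c zero    = 0ℤ
  c (suc i) = d i
  c-rel : ∀ j → ∑ (λ i → c i *ℤ A i j) ≡ 0ℤ
  c-rel zero    = ∑-zero (λ i → trans (cong (c i *ℤ_) (zeroColumn i)) (ℤ.*-zeroʳ (c i)))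
  c-rel (suc j) = cong₂ _+ℤ_ (ℤ.*-zeroˡ (A zero (suc j))) (d-rel j)

-- Clears the first column of the rows other than the pivot row p, and drops row p.
eliminate : ∀ {r} → (Fin (suc (suc r)) → Fin (suc r) → ℤ) → Fin (suc (suc r)) → Fin (suc r) → Fin r → ℤ
eliminate A p i j = A p zero *ℤ A (punchIn p i) (suc j) -ℤ A (punchIn p i) zero *ℤ A p (suc j)

dependent-pivot : ∀ {r} (A : Fin (suc (suc r)) → Fin (suc r) → ℤ) p → A p zero ≢ 0ℤ →
  Dependent (eliminate A p) → Dependent A
dependent-pivot {r} A p a≢0 (d , (i , dᵢ≢0) , d-rel) = c , (punchIn p i , cₚᵢ≢0) , c-rel
  where
  a = A p zero
  row : Fin (suc r) → Fin (suc r) → ℤ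
  row i = A (punchIn p i)
  u = ∑ (λ i → d i *ℤ row i zero)
  -- The weight of the pivot row is chosen to cancel the first column.
  c = insertAt (λ i → a *ℤ d i) p (- u)
  cₚᵢ≢0 : c (punchIn p i) ≢ 0ℤ
  cₚᵢ≢0 cₚᵢ≡0 = dᵢ≢0 (i*j≡0∧j≢0⇒i≡0 (trans (ℤ.*-comm (d i) a)
    (trans (sym (insertAt-punchIn (λ i → a *ℤ d i) p (- u) i)) cₚᵢ≡0)) a≢0)
  expand : ∀ j → ∑ (λ i → c i *ℤ A i j) ≡ - u *ℤ A p j +ℤ ∑ (λ i → a *ℤ d i *ℤ row i j)
  expand j = begin
    ∑ (λ i → c i *ℤ A i j)
      ≡⟨ sum-remove (λ i → c i *ℤ A i j) ⟩
    c p *ℤ A p j +ℤ ∑ (λ i → c (punchIn p i) *ℤ row i j)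
      ≡⟨ cong₂ (λ x y → x *ℤ A p j +ℤ y) (insertAt-lookup (λ i → a *ℤ d i) p (- u))
           (sum-cong-≗ (λ i → cong (_*ℤ row i j) (insertAt-punchIn (λ i → a *ℤ d i) p (- u) i))) ⟩
    - u *ℤ A p j +ℤ ∑ (λ i → a *ℤ d i *ℤ row i j) ∎
  c-rel : ∀ j → ∑ (λ i → c i *ℤ A i j) ≡ 0ℤ
  c-rel zero = begin
    ∑ (λ i → c i *ℤ A i zero)
      ≡⟨ expand zero ⟩
    - u *ℤ a +ℤ ∑ (λ i → a *ℤ d i *ℤ row i zero)
      ≡⟨ cong (- u *ℤ a +ℤ_) (sum-cong-≗ (λ i → ℤ.*-assoc a (d i) (row i zero))) ⟩
    - u *ℤ a +ℤ ∑ (λ i → a *ℤ (d i *ℤ row i zero))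
      ≡⟨ cong (- u *ℤ a +ℤ_) (*-distribˡ-sum a (λ i → d i *ℤ row i zero)) ⟨
    - u *ℤ a +ℤ a *ℤ u
      ≡⟨ cancel u a ⟩
    0ℤ ∎
    where
    cancel : ∀ u a → - u *ℤ a +ℤ a *ℤ u ≡ 0ℤ
    cancel = solve-∀
  c-rel (suc j) = begin
    ∑ (λ i → c i *ℤ A i (suc j))
      ≡⟨ expand (suc j) ⟩
    - u *ℤ z +ℤ ∑ (λ i → a *ℤ d i *ℤ row i (suc j))
      ≡⟨ cong (- u *ℤ z +ℤ_) (sum-cong-≗ (λ i → split a (d i) (row i (suc j)) (row i zero) z)) ⟩
    - u *ℤ z +ℤ ∑ (λ i → d i *ℤ eliminate A p i j +ℤ d i *ℤ row i zero *ℤ z)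
      ≡⟨ cong (- u *ℤ z +ℤ_) (∑-distrib-+ (λ i → d i *ℤ eliminate A p i j) (λ i → d i *ℤ row i zero *ℤ z)) ⟩
    - u *ℤ z +ℤ (∑ (λ i → d i *ℤ eliminate A p i j) +ℤ ∑ (λ i → d i *ℤ row i zero *ℤ z))
      ≡⟨ cong₂ (λ x y → - u *ℤ z +ℤ (x +ℤ y)) (d-rel j) (sym (*-distribʳ-sum z (λ i → d i *ℤ row i zero))) ⟩
    - u *ℤ z +ℤ (0ℤ +ℤ u *ℤ z)
      ≡⟨ cancel u z ⟩
    0ℤ ∎
    where
    z = A p (suc j)
    split : ∀ a d x y z → a *ℤ d *ℤ x ≡ d *ℤ (a *ℤ x -ℤ y *ℤ z) +ℤ d *ℤ y *ℤ z
    split = solve-∀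
    cancel : ∀ u z → - u *ℤ z +ℤ (0ℤ +ℤ u *ℤ z) ≡ 0ℤ
    cancel = solve-∀

rows-dependent : ∀ r (A : Fin (suc r) → Fin r → ℤ) → Dependent A
rows-dependent zero    A = (λ _ → 1ℤ) , (zero , λ ()) , λ ()
rows-dependent (suc r) A with Fin.all? (λ i → A i zero ≟ 0ℤ)
... | yes zeroColumn = dependent-zeroColumn A zeroColumn (rows-dependent r (λ i j → A (suc i) (suc j)))
... | no ¬zeroColumn =
  let (p , a≢0) = Fin.¬∀⟶∃¬ _ _ (λ i → A i zero ≟ 0ℤ) ¬zeroColumn
  in dependent-pivot A p a≢0 (rows-dependent r (eliminate A p))

-- A rank criterion

triangular⇒LinIndep : ∀ r (v : Fin r → QSymCoeffs) (t : Fin r → List ℕ) (h : Fin r → ℕ) →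
  (∀ j → v j (t j) ≢ 0ℤ) → (∀ i j → i ≢ j → v i (t j) ≢ 0ℤ → h i < h j) → LinIndep r v
triangular⇒LinIndep zero    v t h diagonal upper c rel ()
triangular⇒LinIndep (suc r) v t h diagonal upper c rel i = vanishes (suc (h i)) i ℕ.≤-refl
  where
  vanishes : ∀ k j → h j < k → c j ≡ 0ℤ
  vanishes (suc k) j hⱼ<k = i*j≡0∧j≢0⇒i≡0 cⱼvⱼ≡0 (diagonal j)
    where
    others : ∀ i → i ≢ j → c i *ℤ v i (t j) ≡ 0ℤ
    others i i≢j with v i (t j) ≟ 0ℤ
    ... | yes vᵢ≡0 = trans (cong (c i *ℤ_) vᵢ≡0) (ℤ.*-zeroʳ (c i))
    ... | no  vᵢ≢0 = trans (cong (_*ℤ v i (t j)) (vanishes k i hᵢ<k)) (ℤ.*-zeroˡ (v i (t j)))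
      where
      hᵢ<k : h i < k
      hᵢ<k = ℕ.<-≤-trans (upper i j i≢j vᵢ≢0) (ℕ.≤-pred hⱼ<k)
    cⱼvⱼ≡0 : c j *ℤ v j (t j) ≡ 0ℤ
    cⱼvⱼ≡0 = begin
      c j *ℤ v j (t j)                    ≡⟨ ∑-single j others ⟨
      ∑ (λ i → c i *ℤ v i (t j))          ≡⟨ Σ≡∑ (suc r) (λ i → c i *ℤ v i (t j)) ⟨
      Σ (suc r) (λ i → c i *ℤ v i (t j))  ≡⟨ rel (t j) ⟩
      0ℤ                                  ∎

Vanishes : (QSymCoeffs → Set) → List ℕ → Set
Vanishes V β = ∀ f → V f → f β ≡ 0ℤ

Proportional : (QSymCoeffs → Set) → List ℕ → List ℕ → Set
Proportional V β β′ = ∃₂ λ a b → a ≢ 0ℤ × (∀ f → V f → a *ℤ f β ≡ b *ℤ f β′)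

DeterminedBy : ∀ {r} → (QSymCoeffs → Set) → (Fin r → List ℕ) → Set
DeterminedBy V t = ∀ β → Vanishes V β ⊎ ∃ λ j → Proportional V β (t j)

determined⇒¬LinIndep : ∀ {V} r (t : Fin r → List ℕ) → DeterminedBy V t →
  (w : Fin (suc r) → QSymCoeffs) → (∀ i → V (w i)) → ¬ LinIndep (suc r) w
determined⇒¬LinIndep r t determined w w∈V independent
  with rows-dependent r (λ i j → w i (t j))
... | c , (i , cᵢ≢0) , c-rel = cᵢ≢0 (independent c rel i)
  where
  rel : ∀ β → Σ (suc r) (λ i → c i *ℤ w i β) ≡ 0ℤ
  rel β with determined β
  ... | inj₁ vanishes = trans (Σ≡∑ (suc r) (λ i → c i *ℤ w i β))
    (∑-zero (λ i → trans (cong (c i *ℤ_) (vanishes (w i) (w∈V i))) (ℤ.*-zeroʳ (c i))))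
  ... | inj₂ (j , a , b , a≢0 , proportional) = i*j≡0∧i≢0⇒j≡0 (begin
    a *ℤ Σ (suc r) (λ i → c i *ℤ w i β)  ≡⟨ cong (a *ℤ_) (Σ≡∑ (suc r) (λ i → c i *ℤ w i β)) ⟩
    a *ℤ ∑ (λ i → c i *ℤ w i β)          ≡⟨ ∑-ratio c (λ i → w i β) (λ i → w i (t j)) a b
                                              (λ i → proportional (w i) (w∈V i)) ⟩
    b *ℤ ∑ (λ i → c i *ℤ w i (t j))      ≡⟨ cong (b *ℤ_) (c-rel j) ⟩
    b *ℤ 0ℤ                              ≡⟨ ℤ.*-zeroʳ b ⟩
    0ℤ                                   ∎) a≢0

hasRank-byTestPoints : ∀ n r (t : Fin r → List ℕ) → DeterminedBy (InΞ n) t →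
  (v : Fin r → QSymCoeffs) (h : Fin r → ℕ) → (∀ i → InΞ n (v i)) →
  (∀ j → v j (t j) ≢ 0ℤ) → (∀ i j → i ≢ j → v i (t j) ≢ 0ℤ → h i < h j) → HasRank n r
hasRank-byTestPoints n r t determined v h v∈Ξ diagonal upper =
  (v , v∈Ξ , triangular⇒LinIndep r v t h diagonal upper) , determined⇒¬LinIndep r t determined

InΞ-ratio : ∀ {n f} β β′ a b → InΞ n f →
  (∀ α → T (isComp n α) → Shifted n α → a *ℤ θ n α β ≡ b *ℤ θ n α β′) →
  a *ℤ f β ≡ b *ℤ f β′
InΞ-ratio {n} {f} β β′ a b (m , α , c , α-shifted , f≡) θ-ratio = begin
  a *ℤ f β
    ≡⟨ cong (a *ℤ_) (trans (f≡ β) (Σ≡∑ m (λ k → c k *ℤ θ n (α k) β))) ⟩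
  a *ℤ ∑ (λ k → c k *ℤ θ n (α k) β)
    ≡⟨ ∑-ratio c (λ k → θ n (α k) β) (λ k → θ n (α k) β′) a b
         (λ k → θ-ratio (α k) (proj₁ (α-shifted k)) (proj₂ (α-shifted k))) ⟩
  b *ℤ ∑ (λ k → c k *ℤ θ n (α k) β′)
    ≡⟨ cong (b *ℤ_) (trans (f≡ β′) (Σ≡∑ m (λ k → c k *ℤ θ n (α k) β′))) ⟨
  b *ℤ f β′ ∎

θ-composition : ∀ n α β → T (isComp n β) → θ n α β ≡ (if condᵇ α β then + (2 ^ length β) else 0ℤ)
θ-composition n α β β⊨n with isComp n β
... | true = refl

θ-nonComposition : ∀ n α β → ¬ T (isComp n β) → θ n α β ≡ 0ℤ
θ-nonComposition n α β β⊭n with isComp n β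
... | true  = ⊥-elim (β⊭n _)
... | false = refl

θ∈Ξ : ∀ {n α} → T (isComp n α) → Shifted n α → InΞ n (θ n α)
θ∈Ξ {n} {α} α⊨n α-shifted = 1 , (λ _ → α) , (λ _ → 1ℤ) , (λ _ → α⊨n , α-shifted) ,
  λ β → sym (trans (ℤ.+-identityʳ _) (ℤ.*-identityˡ (θ n α β)))

InΞ-vanishes : ∀ n β → ¬ T (isComp n β) → Vanishes (InΞ n) β
InΞ-vanishes n β β⊭n f f∈Ξ = begin
  f β        ≡⟨ ℤ.*-identityˡ (f β) ⟨
  1ℤ *ℤ f β  ≡⟨ InΞ-ratio β β 1ℤ 0ℤ f∈Ξ θ-vanishes ⟩
  0ℤ *ℤ f β  ≡⟨ ℤ.*-zeroˡ (f β) ⟩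
  0ℤ         ∎
  where
  θ-vanishes : ∀ α → T (isComp n α) → Shifted n α → 1ℤ *ℤ θ n α β ≡ 0ℤ *ℤ θ n α β
  θ-vanishes α _ _ = begin
    1ℤ *ℤ θ n α β  ≡⟨ ℤ.*-identityˡ (θ n α β) ⟩
    θ n α β        ≡⟨ θ-nonComposition n α β β⊭n ⟩
    0ℤ             ≡⟨ ℤ.*-zeroˡ (θ n α β) ⟨
    0ℤ *ℤ θ n α β  ∎

2^≢0 : ∀ k → + (2 ^ k) ≢ 0ℤ
2^≢0 k 2^k≡0 with ℕ.m^n≡0⇒m≡0 2 k (ℤ.+-injective 2^k≡0)
... | ()

if-swap : ∀ c (a b : ℤ) → b *ℤ (if c then a else 0ℤ) ≡ a *ℤ (if c then b else 0ℤ)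
if-swap true  a b = ℤ.*-comm b a
if-swap false a b = trans (ℤ.*-zeroʳ b) (sym (ℤ.*-zeroʳ a))

Bits : Set
Bits = List Bool

bit : ℕ → Bits → Bool
bit k       []      = false
bit zero    (b ∷ _) = b
bit (suc k) (_ ∷ x) = bit k x

allSet : (ℕ → Bool) → Bits → Bool
allSet H []          = true
allSet H (false ∷ y) = allSet (H ∘ suc) y
allSet H (true  ∷ y) = H 0 ∧ allSet (H ∘ suc) y

infix 4 _⊆ᵇ_
_⊆ᵇ_ : Bits → Bits → Bool
y ⊆ᵇ x = allSet (λ k → bit k x) y

weight : Bits → ℕ
weight []          = 0
weight (false ∷ x) = weight x
weight (true  ∷ x) = suc (weight x)

pairOr : Bits → Bits
pairOr []          = []
pairOr (_ ∷ [])    = []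
pairOr (b ∷ c ∷ x) = (b ∨ c) ∷ pairOr (c ∷ x)

allSet-cong : ∀ {H H′} y → (∀ k → k < length y → H k ≡ H′ k) → allSet H y ≡ allSet H′ y
allSet-cong []          H≡H′ = refl
allSet-cong (false ∷ y) H≡H′ = allSet-cong y (λ k k<∣y∣ → H≡H′ (suc k) (s≤s k<∣y∣))
allSet-cong (true  ∷ y) H≡H′ =
  cong₂ _∧_ (H≡H′ 0 (s≤s z≤n)) (allSet-cong y (λ k k<∣y∣ → H≡H′ (suc k) (s≤s k<∣y∣)))

bit-pairOr : ∀ k x → suc k < length x → bit k (pairOr x) ≡ bit k x ∨ bit (suc k) x
bit-pairOr zero    (b ∷ [])    (s≤s ())
bit-pairOr zero    (b ∷ c ∷ x) _                = refl
bit-pairOr (suc k) (b ∷ c ∷ x) (s≤s k+1<∣c∷x∣) = bit-pairOr k (c ∷ x) k+1<∣c∷x∣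

⊆ᵇ-refl : ∀ x → (x ⊆ᵇ x) ≡ true
⊆ᵇ-refl []          = refl
⊆ᵇ-refl (false ∷ x) = ⊆ᵇ-refl x
⊆ᵇ-refl (true  ∷ x) = ⊆ᵇ-refl x

⊆ᵇ⇒weight≤ : ∀ y x → length y ≡ length x → (y ⊆ᵇ x) ≡ true → weight y ≤ weight x
⊆ᵇ⇒weight≤ []          []          _ _ = z≤n
⊆ᵇ⇒weight≤ (false ∷ y) (false ∷ x) len y⊆x = ⊆ᵇ⇒weight≤ y x (ℕ.suc-injective len) y⊆x
⊆ᵇ⇒weight≤ (false ∷ y) (true  ∷ x) len y⊆x = ℕ.m≤n⇒m≤1+n (⊆ᵇ⇒weight≤ y x (ℕ.suc-injective len) y⊆x)
⊆ᵇ⇒weight≤ (true  ∷ y) (true  ∷ x) len y⊆x = s≤s (⊆ᵇ⇒weight≤ y x (ℕ.suc-injective len) y⊆x)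

⊆ᵇ⇒weight< : ∀ y x → length y ≡ length x → (y ⊆ᵇ x) ≡ true → y ≢ x → weight y < weight x
⊆ᵇ⇒weight< []          []          _ _ y≢x = ⊥-elim (y≢x refl)
⊆ᵇ⇒weight< (false ∷ y) (false ∷ x) len y⊆x y≢x =
  ⊆ᵇ⇒weight< y x (ℕ.suc-injective len) y⊆x (y≢x ∘ cong (false ∷_))
⊆ᵇ⇒weight< (false ∷ y) (true  ∷ x) len y⊆x y≢x = s≤s (⊆ᵇ⇒weight≤ y x (ℕ.suc-injective len) y⊆x)
⊆ᵇ⇒weight< (true  ∷ y) (true  ∷ x) len y⊆x y≢x =
  s≤s (⊆ᵇ⇒weight< y x (ℕ.suc-injective len) y⊆x (y≢x ∘ cong (true ∷_)))

-- Compositions of m + 1 as bit strings of length m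

incrementHead : List ℕ → List ℕ
incrementHead []      = []
incrementHead (a ∷ α) = suc a ∷ α

-- x is the indicator of the descent set: k + 1 ∈ I (fromBits x) iff x has bit k set.
fromBits : Bits → List ℕ
fromBits []          = 1 ∷ []
fromBits (true  ∷ x) = 1 ∷ fromBits x
fromBits (false ∷ x) = incrementHead (fromBits x)

fromBits-cons : ∀ x → ∃₂ λ a α → fromBits x ≡ suc a ∷ α
fromBits-cons []          = 0 , [] , refl
fromBits-cons (true  ∷ x) = 0 , fromBits x , refl
fromBits-cons (false ∷ x) with fromBits-cons x
... | a , α , eq = suc a , α , cong incrementHead eq

sum-fromBits : ∀ x → sum (fromBits x) ≡ suc (length x)
sum-fromBits []          = refl
sum-fromBits (true  ∷ x) = cong suc (sum-fromBits x)
sum-fromBits (false ∷ x) with fromBits x | sum-fromBits x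
... | a ∷ α | eq = cong suc eq

all-positive-fromBits : ∀ x → T (all (1 ≤ᵇ_) (fromBits x))
all-positive-fromBits []          = _
all-positive-fromBits (true  ∷ x) = all-positive-fromBits x
all-positive-fromBits (false ∷ x) with fromBits x | all-positive-fromBits x
... | []        | _        = _
... | suc a ∷ α | positive = positive

fromBits⊨ : ∀ {m} x → length x ≡ m → T (isComp (suc m) (fromBits x))
fromBits⊨ x refl = Equivalence.from Bool.T-∧
  (all-positive-fromBits x , ℕ.≡⇒≡ᵇ _ _ (sum-fromBits x))

fromBits-onto : ∀ a α → T (all (1 ≤ᵇ_) α) → ∃ λ x → fromBits x ≡ suc a ∷ α
fromBits-onto zero    []          _        = [] , refl
fromBits-onto zero    (suc b ∷ α) positive with fromBits-onto b α positive
... | x , eq = true ∷ x , cong (1 ∷_) eq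
fromBits-onto (suc a) α           positive with fromBits-onto a α positive
... | x , eq = false ∷ x , cong incrementHead eq

fromBits-surjective : ∀ m β → T (isComp (suc m) β) → ∃ λ x → length x ≡ m × fromBits x ≡ β
fromBits-surjective m (suc a ∷ α) β⊨n with Equivalence.to Bool.T-∧ β⊨n
... | positive , sum≡ with fromBits-onto a α positive
... | x , eq = x , ℕ.suc-injective (trans (sym (sum-fromBits x)) (trans (cong sum eq) (ℕ.≡ᵇ⇒≡ _ _ sum≡))) , eq

fromBits-true∷-unshifted : ∀ x → ¬ Shifted (suc (length (true ∷ x))) (fromBits (true ∷ x))
fromBits-true∷-unshifted x (inj₁ (s≤s ()))
fromBits-true∷-unshifted x (inj₂ (_ , _ , refl , s≤s ()))

-- If x encodes the descent set I of a composition of m + 1, dilate x encodes (I ∪ (I + 1)) ∩ [m].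
dilate : Bits → Bits
dilate x = pairOr (false ∷ x)

I-incrementHead : ∀ a α → I (suc a ∷ α) ≡ map suc (I (a ∷ α))
I-incrementHead a []      = refl
I-incrementHead a (b ∷ α) = cong (suc a ∷_) (List.map-∘ (I (b ∷ α)))

I-fromBits-true∷ : ∀ x → I (fromBits (true ∷ x)) ≡ 1 ∷ map suc (I (fromBits x))
I-fromBits-true∷ x with fromBits-cons x
... | a , α , eq rewrite eq = refl

I-fromBits-false∷ : ∀ x → I (fromBits (false ∷ x)) ≡ map suc (I (fromBits x))
I-fromBits-false∷ x with fromBits-cons x
... | a , α , eq rewrite eq = I-incrementHead (suc a) α

all-map-suc : ∀ (Q : ℕ → Bool) L → all Q (map suc L) ≡ all (Q ∘ suc) L
all-map-suc Q L = cong and (sym (List.map-∘ L))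

elemᵇ-map-suc : ∀ k L → elemᵇ (suc k) (map suc L) ≡ elemᵇ k L
elemᵇ-map-suc k L = cong or (sym (List.map-∘ L))

0∉map-suc : ∀ L → elemᵇ 0 (map suc L) ≡ false
0∉map-suc []      = refl
0∉map-suc (a ∷ L) = 0∉map-suc L

elemᵇ-++ : ∀ k L L′ → elemᵇ k (L ++ L′) ≡ elemᵇ k L ∨ elemᵇ k L′
elemᵇ-++ k []      L′ = refl
elemᵇ-++ k (a ∷ L) L′ = trans (cong ((k ≡ᵇ a) ∨_) (elemᵇ-++ k L L′)) (sym (Bool.∨-assoc (k ≡ᵇ a) _ _))

all-I-fromBits : ∀ (Q : ℕ → Bool) y → all Q (I (fromBits y)) ≡ allSet (Q ∘ suc) y
all-I-fromBits Q []          = refl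
all-I-fromBits Q (true  ∷ y) rewrite I-fromBits-true∷ y =
  cong (Q 1 ∧_) (trans (all-map-suc Q (I (fromBits y))) (all-I-fromBits (Q ∘ suc) y))
all-I-fromBits Q (false ∷ y) rewrite I-fromBits-false∷ y =
  trans (all-map-suc Q (I (fromBits y))) (all-I-fromBits (Q ∘ suc) y)

elemᵇ-I-fromBits : ∀ k x → elemᵇ k (I (fromBits x)) ≡ bit k (false ∷ x)
elemᵇ-I-fromBits zero          []          = refl
elemᵇ-I-fromBits (suc k)       []          = refl
elemᵇ-I-fromBits zero          (true  ∷ x) rewrite I-fromBits-true∷ x = 0∉map-suc (I (fromBits x))
elemᵇ-I-fromBits (suc zero)    (true  ∷ x) rewrite I-fromBits-true∷ x = refl
elemᵇ-I-fromBits (suc (suc k)) (true  ∷ x) rewrite I-fromBits-true∷ x =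
  trans (elemᵇ-map-suc (suc k) (I (fromBits x))) (elemᵇ-I-fromBits (suc k) x)
elemᵇ-I-fromBits zero          (false ∷ x) rewrite I-fromBits-false∷ x = 0∉map-suc (I (fromBits x))
elemᵇ-I-fromBits (suc k)       (false ∷ x) rewrite I-fromBits-false∷ x =
  trans (elemᵇ-map-suc k (I (fromBits x))) (elemᵇ-I-fromBits k x)

condᵇ-fromBits : ∀ y x → length y ≡ length x → condᵇ (fromBits y) (fromBits x) ≡ (y ⊆ᵇ dilate x)
condᵇ-fromBits y x ∣y∣≡∣x∣ = begin
  condᵇ (fromBits y) (fromBits x)                    ≡⟨ all-I-fromBits (λ a → elemᵇ a (L ++ map suc L)) y ⟩
  allSet (λ k → elemᵇ (suc k) (L ++ map suc L)) y    ≡⟨ allSet-cong y (λ k k<∣y∣ → elemᵇ≡bit k (k<∣x∣ k<∣y∣)) ⟩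
  y ⊆ᵇ dilate x                                      ∎
  where
  L = I (fromBits x)
  k<∣x∣ : ∀ {k} → k < length y → k < length x
  k<∣x∣ k<∣y∣ = ≤-trans k<∣y∣ (≤-reflexive ∣y∣≡∣x∣)
  elemᵇ≡bit : ∀ k → k < length x → elemᵇ (suc k) (L ++ map suc L) ≡ bit k (dilate x)
  elemᵇ≡bit k k<∣x∣ = begin
    elemᵇ (suc k) (L ++ map suc L)                    ≡⟨ elemᵇ-++ (suc k) L (map suc L) ⟩
    elemᵇ (suc k) L ∨ elemᵇ (suc k) (map suc L)       ≡⟨ cong₂ _∨_ (elemᵇ-I-fromBits (suc k) x)
                                                           (trans (elemᵇ-map-suc k L) (elemᵇ-I-fromBits k x)) ⟩
    bit k x ∨ bit k (false ∷ x)                       ≡⟨ Bool.∨-comm (bit k x) (bit k (false ∷ x)) ⟩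
    bit k (false ∷ x) ∨ bit k x                       ≡⟨ bit-pairOr k (false ∷ x) (s≤s k<∣x∣) ⟨
    bit k (dilate x)                                  ∎

false∷⊆ᵇdilate : ∀ z x → (false ∷ z ⊆ᵇ dilate x) ≡ (z ⊆ᵇ pairOr x)
false∷⊆ᵇdilate z []      = refl
false∷⊆ᵇdilate z (c ∷ x) = refl

condᵇ-shifted : ∀ m α x q → T (isComp (suc m) α) → Shifted (suc m) α →
  length x ≡ m → length q ≡ m → pairOr x ≡ pairOr q → condᵇ α (fromBits x) ≡ condᵇ α (fromBits q)
condᵇ-shifted m α x q α⊨n α-shifted ∣x∣≡m ∣q∣≡m pairOr-x≡q
  with fromBits-surjective m α α⊨n
... | y , ∣y∣≡m , refl
  rewrite condᵇ-fromBits y x (trans ∣y∣≡m (sym ∣x∣≡m)) | condᵇ-fromBits y q (trans ∣y∣≡m (sym ∣q∣≡m))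
  = agree y ∣y∣≡m α-shifted
  where
  agree : ∀ y → length y ≡ m → Shifted (suc m) (fromBits y) → (y ⊆ᵇ dilate x) ≡ (y ⊆ᵇ dilate q)
  agree []          _    _          = refl
  agree (false ∷ z) _    _          =
    trans (false∷⊆ᵇdilate z x) (trans (cong (z ⊆ᵇ_) pairOr-x≡q) (sym (false∷⊆ᵇdilate z q)))
  agree (true  ∷ z) refl y-shifted = ⊥-elim (fromBits-true∷-unshifted z y-shifted)

shiftedBits : Bits → Bits
shiftedBits []      = []
shiftedBits (b ∷ p) = false ∷ pairOr (b ∷ p)

length-pairOr : ∀ p → length (pairOr p) ≡ length p ∸ 1
length-pairOr []          = refl
length-pairOr (b ∷ [])    = refl
length-pairOr (b ∷ c ∷ p) = cong suc (length-pairOr (c ∷ p))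

length-shiftedBits : ∀ p → length (shiftedBits p) ≡ length p
length-shiftedBits []      = refl
length-shiftedBits (b ∷ p) = cong suc (length-pairOr (b ∷ p))

fromBits-shiftedBits-shifted : ∀ {m} p → length p ≡ m → Shifted (suc m) (fromBits (shiftedBits p))
fromBits-shiftedBits-shifted []      refl = inj₁ (s≤s z≤n)
fromBits-shiftedBits-shifted (b ∷ p) refl with fromBits-cons (pairOr (b ∷ p))
... | a , α , eq = inj₂ (suc (suc a) , α , cong incrementHead eq , s≤s (s≤s z≤n))

condᵇ-shiftedBits : ∀ p q → length p ≡ length q →
  condᵇ (fromBits (shiftedBits p)) (fromBits q) ≡ (pairOr p ⊆ᵇ pairOr q)
condᵇ-shiftedBits []      [] _       = refl
condᵇ-shiftedBits (b ∷ p) q  ∣p∣≡∣q∣ =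
  trans (condᵇ-fromBits (shiftedBits (b ∷ p)) q (trans (length-shiftedBits (b ∷ p)) ∣p∣≡∣q∣))
        (false∷⊆ᵇdilate (pairOr (b ∷ p)) q)

θ-shiftedBits∈Ξ : ∀ {m} p → length p ≡ m → InΞ (suc m) (θ (suc m) (fromBits (shiftedBits p)))
θ-shiftedBits∈Ξ p ∣p∣≡m = θ∈Ξ (fromBits⊨ (shiftedBits p) (trans (length-shiftedBits p) ∣p∣≡m))
                              (fromBits-shiftedBits-shifted p ∣p∣≡m)

θ-shiftedBits : ∀ m p q → length p ≡ m → length q ≡ m →
  θ (suc m) (fromBits (shiftedBits p)) (fromBits q) ≡
  (if pairOr p ⊆ᵇ pairOr q then + (2 ^ length (fromBits q)) else 0ℤ)
θ-shiftedBits m p q ∣p∣≡m ∣q∣≡m =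
  trans (θ-composition (suc m) (fromBits (shiftedBits p)) (fromBits q) (fromBits⊨ q ∣q∣≡m))
        (cong (λ c → if c then + (2 ^ length (fromBits q)) else 0ℤ)
              (condᵇ-shiftedBits p q (trans ∣p∣≡m (sym ∣q∣≡m))))

fibre-proportional : ∀ m x q → length x ≡ m → length q ≡ m → pairOr x ≡ pairOr q →
  Proportional (InΞ (suc m)) (fromBits x) (fromBits q)
fibre-proportional m x q ∣x∣≡m ∣q∣≡m x~q =
  Kq , Kx , 2^≢0 (length (fromBits q)) , λ f f∈Ξ → InΞ-ratio (fromBits x) (fromBits q) Kq Kx f∈Ξ ratio
  where
  Kx Kq : ℤ
  Kx = + (2 ^ length (fromBits x))
  Kq = + (2 ^ length (fromBits q))
  ratio : ∀ α → T (isComp (suc m) α) → Shifted (suc m) α →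
    Kq *ℤ θ (suc m) α (fromBits x) ≡ Kx *ℤ θ (suc m) α (fromBits q)
  ratio α α⊨n α-shifted = begin
    Kq *ℤ θ (suc m) α (fromBits x)
      ≡⟨ cong (Kq *ℤ_) (θ-composition (suc m) α (fromBits x) (fromBits⊨ x ∣x∣≡m)) ⟩
    Kq *ℤ (if condᵇ α (fromBits x) then Kx else 0ℤ)
      ≡⟨ cong (λ c → Kq *ℤ (if c then Kx else 0ℤ)) (condᵇ-shifted m α x q α⊨n α-shifted ∣x∣≡m ∣q∣≡m x~q) ⟩
    Kq *ℤ (if condᵇ α (fromBits q) then Kx else 0ℤ)
      ≡⟨ if-swap (condᵇ α (fromBits q)) Kx Kq ⟩
    Kx *ℤ (if condᵇ α (fromBits q) then Kq else 0ℤ)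
      ≡⟨ cong (Kx *ℤ_) (θ-composition (suc m) α (fromBits q) (fromBits⊨ q ∣q∣≡m)) ⟨
    Kx *ℤ θ (suc m) α (fromBits q) ∎

-- Representatives of the fibres of pairOr

-- Split by the first bit of pairOr x: pairOr (false ∷ true ∷ x) ≡ pairOr (true ∷ true ∷ x),
-- and pairOr (false ∷ false ∷ x) ≡ false ∷ dilate x.
mutual
  pairOrReps : ℕ → List Bits
  pairOrReps zero          = [] ∷ []
  pairOrReps (suc zero)    = (false ∷ []) ∷ []
  pairOrReps (suc (suc m)) = map (true ∷_) (pairOrReps (suc m)) ++ map (λ q → false ∷ false ∷ q) (dilateReps m)

  dilateReps : ℕ → List Bits
  dilateReps zero    = [] ∷ []
  dilateReps (suc m) = map (true ∷_) (pairOrReps m) ++ map (false ∷_) (dilateReps m)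

mutual
  pairOrReps-length : ∀ m → All (λ p → length p ≡ m) (pairOrReps m)
  pairOrReps-length zero          = refl ∷ []
  pairOrReps-length (suc zero)    = refl ∷ []
  pairOrReps-length (suc (suc m)) = All.++⁺
    (All.map⁺ (All.map (cong suc) (pairOrReps-length (suc m))))
    (All.map⁺ (All.map (cong (λ k → 2 + k)) (dilateReps-length m)))

  dilateReps-length : ∀ m → All (λ q → length q ≡ m) (dilateReps m)
  dilateReps-length zero    = refl ∷ []
  dilateReps-length (suc m) = All.++⁺
    (All.map⁺ (All.map (cong suc) (pairOrReps-length m)))
    (All.map⁺ (All.map (cong suc) (dilateReps-length m)))

pairOr-true∷ : ∀ p x → length p ≡ length x → pairOr p ≡ pairOr x → pairOr (true ∷ p) ≡ pairOr (true ∷ x)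
pairOr-true∷ []      []      _ _  = refl
pairOr-true∷ (a ∷ p) (b ∷ x) _ eq = cong (true ∷_) eq

pairOr-true∷-injective : ∀ p x → pairOr (true ∷ p) ≡ pairOr (true ∷ x) → pairOr p ≡ pairOr x
pairOr-true∷-injective []      []      _  = refl
pairOr-true∷-injective (a ∷ p) (b ∷ x) eq = List.∷-injectiveʳ eq

Covers : (Bits → Bits) → ℕ → List Bits → Set
Covers f m reps = ∀ x → length x ≡ m → Any (λ p → length p ≡ m × f p ≡ f x) reps

mutual
  pairOrReps-covers : ∀ m → Covers pairOr m (pairOrReps m)
  pairOrReps-covers zero          []          _  = here (refl , refl)
  pairOrReps-covers (suc zero)    (b ∷ [])    _  = here (refl , refl)
  pairOrReps-covers (suc (suc m)) (true ∷ x)          ∣x∣≡m =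
    pairOrReps-covers-true∷ m x (ℕ.suc-injective ∣x∣≡m)
  pairOrReps-covers (suc (suc m)) (false ∷ true ∷ x)  ∣x∣≡m =
    pairOrReps-covers-true∷ m (true ∷ x) (ℕ.suc-injective ∣x∣≡m)
  pairOrReps-covers (suc (suc m)) (false ∷ false ∷ x) ∣x∣≡m = Any.++⁺ʳ _ (Any.map⁺ (Any.map
    (λ (∣q∣≡m , eq) → cong (λ k → 2 + k) ∣q∣≡m , cong (false ∷_) eq)
    (dilateReps-covers m x (ℕ.suc-injective (ℕ.suc-injective ∣x∣≡m)))))

  pairOrReps-covers-true∷ : ∀ m x → length x ≡ suc m →
    Any (λ p → length p ≡ 2 + m × pairOr p ≡ pairOr (true ∷ x)) (pairOrReps (2 + m))
  pairOrReps-covers-true∷ m x ∣x∣≡m = Any.++⁺ˡ (Any.map⁺ (Any.map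
    (λ {p} (∣p∣≡m , eq) → cong suc ∣p∣≡m , pairOr-true∷ p x (trans ∣p∣≡m (sym ∣x∣≡m)) eq)
    (pairOrReps-covers (suc m) x ∣x∣≡m)))

  dilateReps-covers : ∀ m → Covers dilate m (dilateReps m)
  dilateReps-covers zero    []          _  = here (refl , refl)
  dilateReps-covers (suc m) (true ∷ x) ∣x∣≡m = Any.++⁺ˡ (Any.map⁺ (Any.map
    (λ {p} (∣p∣≡m , eq) → cong suc ∣p∣≡m ,
      cong (true ∷_) (pairOr-true∷ p x (trans ∣p∣≡m (sym (ℕ.suc-injective ∣x∣≡m))) eq))
    (pairOrReps-covers m x (ℕ.suc-injective ∣x∣≡m))))
  dilateReps-covers (suc m) (false ∷ x) ∣x∣≡m = Any.++⁺ʳ _ (Any.map⁺ (Any.map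
    (λ (∣q∣≡m , eq) → cong suc ∣q∣≡m , cong (false ∷_) eq)
    (dilateReps-covers m x (ℕ.suc-injective ∣x∣≡m))))

Distinct : (Bits → Bits) → List Bits → Set
Distinct f = AllPairs (λ p q → f p ≢ f q)

mutual
  pairOrReps-distinct : ∀ m → Distinct pairOr (pairOrReps m)
  pairOrReps-distinct zero          = [] ∷ []
  pairOrReps-distinct (suc zero)    = [] ∷ []
  pairOrReps-distinct (suc (suc m)) = AllPairs.++⁺
    (AllPairs.map⁺ (AllPairs.map (λ {p} {x} p≢x → p≢x ∘ pairOr-true∷-injective p x)
      (pairOrReps-distinct (suc m))))
    (AllPairs.map⁺ (AllPairs.map (λ q≢x → q≢x ∘ List.∷-injectiveʳ) (dilateReps-distinct m)))
    (All.map⁺ (All.map (λ {p} ∣p∣≡m → All.map⁺ (All.universal (λ q → heads-differ p q ∣p∣≡m) _))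
      (pairOrReps-length (suc m))))
    where
    heads-differ : ∀ p q → length p ≡ suc m → pairOr (true ∷ p) ≢ pairOr (false ∷ false ∷ q)
    heads-differ (c ∷ p) q _ ()

  dilateReps-distinct : ∀ m → Distinct dilate (dilateReps m)
  dilateReps-distinct zero    = [] ∷ []
  dilateReps-distinct (suc m) = AllPairs.++⁺
    (AllPairs.map⁺ (AllPairs.map (λ {p} {x} p≢x → p≢x ∘ pairOr-true∷-injective p x ∘ List.∷-injectiveʳ)
      (pairOrReps-distinct m)))
    (AllPairs.map⁺ (AllPairs.map (λ q≢x → q≢x ∘ List.∷-injectiveʳ) (dilateReps-distinct m)))
    (All.map⁺ (All.universal (λ p → All.map⁺ (All.universal (λ q ()) _)) _))

lookup-injective : ∀ {f : Bits → Bits} {reps} → Distinct f reps →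
  ∀ i j → f (lookup reps i) ≡ f (lookup reps j) → i ≡ j
lookup-injective (_ ∷ _)            zero    zero    _  = refl
lookup-injective (p≢ ∷ _)           zero    (suc j) eq = ⊥-elim (All.lookup p≢ (Membership.∈-lookup j) eq)
lookup-injective (p≢ ∷ _)           (suc i) zero    eq = ⊥-elim (All.lookup p≢ (Membership.∈-lookup i) (sym eq))
lookup-injective (_ ∷ distinct)     (suc i) (suc j) eq = cong suc (lookup-injective distinct i j eq)

length-map-++-map : ∀ {A B C : Set} (f : A → C) (g : B → C) xs ys →
  length (map f xs ++ map g ys) ≡ length xs + length ys
length-map-++-map f g xs ys =
  trans (List.length-++ (map f xs)) (cong₂ _+_ (List.length-map f xs) (List.length-map g ys))

pairOrReps-recurrence : ∀ m → length (pairOrReps (4 + m)) ≡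
  length (pairOrReps (3 + m)) + length (pairOrReps (2 + m)) + length (pairOrReps m)
pairOrReps-recurrence m = begin
  P (4 + m)                              ≡⟨ P-suc-suc (2 + m) ⟩
  P (3 + m) + Q (2 + m)                  ≡⟨ cong (λ k → P (3 + m) + k) (Q-suc (1 + m)) ⟩
  P (3 + m) + (P (1 + m) + Q (1 + m))    ≡⟨ cong (λ k → P (3 + m) + (P (1 + m) + k)) (Q-suc m) ⟩
  P (3 + m) + (P (1 + m) + (P m + Q m))  ≡⟨ rearrange (P (3 + m)) (P (1 + m)) (P m) (Q m) ⟩
  P (3 + m) + (P (1 + m) + Q m) + P m    ≡⟨ cong (λ k → P (3 + m) + k + P m) (P-suc-suc m) ⟨
  P (3 + m) + P (2 + m) + P m            ∎
  where
  P Q : ℕ → ℕ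
  P = length ∘ pairOrReps
  Q = length ∘ dilateReps
  P-suc-suc : ∀ k → P (2 + k) ≡ P (1 + k) + Q k
  P-suc-suc k = length-map-++-map _ _ (pairOrReps (1 + k)) (dilateReps k)
  Q-suc : ∀ k → Q (1 + k) ≡ P k + Q k
  Q-suc k = length-map-++-map _ _ (pairOrReps k) (dilateReps k)
  rearrange : ∀ a b c d → a + (b + (c + d)) ≡ a + (b + d) + c
  rearrange = ℕ-solve-∀

Ξ-rank : ∀ m → HasRank (suc m) (length (pairOrReps m))
Ξ-rank m = hasRank-byTestPoints (suc m) r t determined v h
  (λ i → θ-shiftedBits∈Ξ (p i) (∣p∣≡m i)) diagonal upper
  where
  r = length (pairOrReps m)
  p : Fin r → Bits
  p = lookup (pairOrReps m)
  ∣p∣≡m : ∀ i → length (p i) ≡ m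
  ∣p∣≡m i = All.lookup (pairOrReps-length m) (Membership.∈-lookup i)
  t : Fin r → List ℕ
  t j = fromBits (p j)
  v : Fin r → QSymCoeffs
  v i = θ (suc m) (fromBits (shiftedBits (p i)))
  h : Fin r → ℕ
  h i = weight (pairOr (p i))

  entry : ∀ i j → v i (t j) ≡ (if pairOr (p i) ⊆ᵇ pairOr (p j) then + (2 ^ length (t j)) else 0ℤ)
  entry i j = θ-shiftedBits m (p i) (p j) (∣p∣≡m i) (∣p∣≡m j)

  diagonal : ∀ j → v j (t j) ≢ 0ℤ
  diagonal j rewrite entry j j | ⊆ᵇ-refl (pairOr (p j)) = 2^≢0 (length (t j))

  upper : ∀ i j → i ≢ j → v i (t j) ≢ 0ℤ → h i < h j
  upper i j i≢j vᵢⱼ≢0 with pairOr (p i) ⊆ᵇ pairOr (p j) in pᵢ⊆pⱼ | entry i j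
  ... | false | vᵢⱼ≡0 = ⊥-elim (vᵢⱼ≢0 vᵢⱼ≡0)
  ... | true  | _     = ⊆ᵇ⇒weight< (pairOr (p i)) (pairOr (p j)) ∣pairOr-pᵢ∣≡∣pairOr-pⱼ∣ pᵢ⊆pⱼ
                          (i≢j ∘ lookup-injective (pairOrReps-distinct m) i j)
    where
    ∣pairOr-pᵢ∣≡∣pairOr-pⱼ∣ : length (pairOr (p i)) ≡ length (pairOr (p j))
    ∣pairOr-pᵢ∣≡∣pairOr-pⱼ∣ = begin
      length (pairOr (p i))  ≡⟨ length-pairOr (p i) ⟩
      length (p i) ∸ 1       ≡⟨ cong (_∸ 1) (trans (∣p∣≡m i) (sym (∣p∣≡m j))) ⟩
      length (p j) ∸ 1       ≡⟨ length-pairOr (p j) ⟨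
      length (pairOr (p j))  ∎

  determined : DeterminedBy (InΞ (suc m)) t
  determined β with T? (isComp (suc m) β)
  ... | no  β⊭n = inj₁ (InΞ-vanishes (suc m) β β⊭n)
  ... | yes β⊨n with fromBits-surjective m β β⊨n
  ... | x , ∣x∣≡m , refl =
    let covering = pairOrReps-covers m x ∣x∣≡m
        j = Any.index covering
    in inj₂ (j , fibre-proportional m x (p j) ∣x∣≡m (∣p∣≡m j) (sym (proj₂ (Any.lookup-index covering))))

theorem4p3 : ∃ λ (π : ℕ → ℕ) →
    (∀ n → 1 ≤ n → HasRank n (π n)) ×
    π 1 ≡ 1 × π 2 ≡ 1 × π 3 ≡ 2 × π 4 ≡ 4 ×
    (∀ n → 5 ≤ n → π n ≡ π (n ∸ 1) + π (n ∸ 2) + π (n ∸ 4))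
theorem4p3 = π , rank , refl , refl , refl , refl , recurrence
  where
  π : ℕ → ℕ
  π n = length (pairOrReps (n ∸ 1))
  rank : ∀ n → 1 ≤ n → HasRank n (π n)
  rank (suc m) _ = Ξ-rank m
  recurrence : ∀ n → 5 ≤ n → π n ≡ π (n ∸ 1) + π (n ∸ 2) + π (n ∸ 4)
  recurrence _ (s≤s (s≤s (s≤s (s≤s (s≤s {n = m} _))))) = pairOrReps-recurrence m
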